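{- For every positive integer $n$, $|K_n|\le n^{n-1}$.
   Context: An expression is a formal term built from the symbol $x$ using the binary operations $+$ and $\cdot$ (with parentheses); its size is the number of occurrences of $x$ in it, and its value is the polynomial in $\mathbb{Z}[x]$ it computes. The values of expressions are exactly the nonzero polynomials with nonnegative integer coefficients and zero constant term. For such a polynomial $f$, its complexity $||f||$ is the minimum size of an expression whose value is $f$. For $n\ge1$, the $n$-th complexity class $K_n$ is the set of such polynomials $f$ with $||f||=n$. -}

module Defs where

open import Data.Nat using (ℕ; zero; suc; _+_; _*_; _∸_; _≤_)
open import Data.Product using (Σ; _×_)
open import Relation.Binary.PropositionalEquality using (_≡_)

-- A polynomial in ℕ[x] given by its coefficient sequence:
-- (p k) is the coefficient of x^k.
Poly : Set
Poly = ℕ → ℕ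

_≈ₚ_ : Poly → Poly → Set
p ≈ₚ q = ∀ k → p k ≡ q k

sumTo : (ℕ → ℕ) → ℕ → ℕ
sumTo g zero = g zero
sumTo g (suc k) = sumTo g k + g (suc k)

xPoly : Poly
xPoly zero = 0
xPoly (suc zero) = 1
xPoly (suc (suc k)) = 0

_+ₚ_ : Poly → Poly → Poly
(p +ₚ q) k = p k + q k

_*ₚ_ : Poly → Poly → Poly
(p *ₚ q) k = sumTo (λ i → p i * q (k ∸ i)) k

data Expr : Set where
  var : Expr
  _⊕_ : Expr → Expr → Expr
  _⊗_ : Expr → Expr → Expr

size : Expr → ℕ
size var = 1
size (e ⊕ f) = size e + size f
size (e ⊗ f) = size e + size f

value : Expr → Poly
value var = xPoly
value (e ⊕ f) = value e +ₚ value f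
value (e ⊗ f) = value e *ₚ value f

InK : ℕ → Poly → Set
InK n f = Σ Expr (λ e → size e ≡ n × value e ≈ₚ f)
        × (∀ e → value e ≈ₚ f → n ≤ size e)

{-# OPTIONS --safe #-}
-- A member of K_n is the value of some expression of size n, and distinct polynomials need
-- distinct expressions, so |K_n| is at most the number E(n) of expressions of size n.
-- Splitting at the root gives E(1) = 1 and E(n) = 2 Σ_{i+j=n} E(i) E(j); inductively every
-- product E(i) E(j) is at most (n-1)^(i-1) (n-1)^(j-1) = (n-1)^(n-2), so E(n) ≤ 2 (n-1)^(n-1),
-- and 2 (n-1)^(n-1) ≤ n^(n-1) is Bernoulli's inequality (1 + 1/(n-1))^(n-1) ≥ 2.
module Submission where

open import Defs
open import Data.Nat using (ℕ; zero; suc; _+_; _*_; _^_; _∸_; _≤_; _<_; z≤n; s≤s; s≤s⁻¹)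
open import Data.Nat.Properties
open import Data.Nat.Tactic.RingSolver using (solve-∀)
open import Data.List
  using (List; []; _∷_; [_]; _++_; length; map; concatMap; cartesianProductWith; upTo)
open import Data.List.Properties using (length-++; length-map; length-upTo; length-removeAt′)
open import Data.List.Relation.Unary.All as All using (All; []; _∷_)
open import Data.List.Relation.Unary.AllPairs as AllPairs using (AllPairs; []; _∷_)
open import Data.List.Relation.Unary.Any using (Any; here; there; index; _─_)
open import Data.List.Relation.Binary.Subset.Propositional using (_⊆_)
open import Data.List.Membership.Propositional using (_∈_; lose)
open import Data.List.Membership.Propositional.Properties
  using (∈-++⁺ˡ; ∈-++⁺ʳ; ∈-cartesianProductWith⁺; ∈-concatMap⁺; ∈-upTo⁺; ∈-upTo⁻)
open import Data.Product using (_,_)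
open import Function using (_∘_)
open import Relation.Binary.PropositionalEquality
  using (_≡_; refl; sym; trans; cong; cong₂; subst)
open import Relation.Nullary using (¬_; contradiction)

module _ {A B : Set} (R : A → B → Set) where

  ─-preserves-Any : ∀ {x z ys} (p : Any (R x) ys) → Any (R z) ys →
                    (∀ {y} → R x y → ¬ R z y) → Any (R z) (ys ─ p)
  ─-preserves-Any (here rx) (here rz) disjoint = contradiction rz (disjoint rx)
  ─-preserves-Any (here _)  (there q) _        = q
  ─-preserves-Any (there _) (here rz) _        = here rz
  ─-preserves-Any (there p) (there q) disjoint = there (─-preserves-Any p q disjoint)

  pigeonhole : ∀ {xs ys} → AllPairs (λ x z → ∀ {y} → R x y → ¬ R z y) xs →
               All (λ x → Any (R x) ys) xs → length xs ≤ length ys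
  pigeonhole []                     []       = z≤n
  pigeonhole {x ∷ xs} {ys} (disjoint ∷ disjoints) (p ∷ ps) = begin
    suc (length xs)       ≤⟨ s≤s (pigeonhole disjoints ps′) ⟩
    suc (length (ys ─ p)) ≡⟨ length-removeAt′ ys (index p) ⟨
    length ys             ∎
    where
    open ≤-Reasoning
    ps′ : All (λ z → Any (R z) (ys ─ p)) xs
    ps′ = All.zipWith {Q = λ z → ∀ {y} → R x y → ¬ R z y}
                      (λ (q , d) → ─-preserves-Any p q d) (ps , disjoint)

bernoulli : ∀ a k → a ^ suc k + suc k * a ^ k ≤ suc a ^ suc k
bernoulli a zero    = ≤-reflexive (+-comm (a * 1) 1)
bernoulli a (suc k) = begin
  a ^ suc (suc k) + suc (suc k) * a ^ suc k                 ≤⟨ m≤m+n _ (suc k * a ^ k) ⟩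
  a ^ suc (suc k) + suc (suc k) * a ^ suc k + suc k * a ^ k ≡⟨ expand a k (a ^ k) ⟩
  suc a * (a ^ suc k + suc k * a ^ k)                       ≤⟨ *-monoʳ-≤ (suc a) (bernoulli a k) ⟩
  suc a ^ suc (suc k)                                       ∎
  where
  open ≤-Reasoning
  expand : ∀ a k x →
           a * (a * x) + suc (suc k) * (a * x) + suc k * x ≡ suc a * (a * x + suc k * x)
  expand = solve-∀

m^i*m^[n∸i]≡m^n : ∀ m {i n} → i ≤ n → m ^ i * m ^ (n ∸ i) ≡ m ^ n
m^i*m^[n∸i]≡m^n m {i} {n} i≤n =
  trans (sym (^-distribˡ-+-* m i (n ∸ i))) (cong (m ^_) (m+[n∸m]≡n i≤n))

length-cartesianProductWith : ∀ {A B C : Set} (f : A → B → C) xs ys →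
                              length (cartesianProductWith f xs ys) ≡ length xs * length ys
length-cartesianProductWith f []       ys = refl
length-cartesianProductWith f (x ∷ xs) ys = trans (length-++ (map (f x) ys))
  (cong₂ _+_ (length-map (f x) ys) (length-cartesianProductWith f xs ys))

length-concatMap-≤ : ∀ {A B : Set} (f : A → List B) {b xs} →
                     All (λ x → length (f x) ≤ b) xs → length (concatMap f xs) ≤ length xs * b
length-concatMap-≤ f []                     = z≤n
length-concatMap-≤ f {xs = x ∷ xs} (p ∷ ps) =
  ≤-trans (≤-reflexive (length-++ (f x))) (+-mono-≤ p (length-concatMap-≤ f ps))

opCount : Expr → ℕ
opCount var     = 0
opCount (e ⊕ g) = suc (opCount e + opCount g)
opCount (e ⊗ g) = suc (opCount e + opCount g)

size≡suc-opCount : ∀ e → size e ≡ suc (opCount e)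
size≡suc-opCount var     = refl
size≡suc-opCount (e ⊕ g) =
  trans (cong₂ _+_ (size≡suc-opCount e) (size≡suc-opCount g)) (cong suc (+-suc _ _))
size≡suc-opCount (e ⊗ g) =
  trans (cong₂ _+_ (size≡suc-opCount e) (size≡suc-opCount g)) (cong suc (+-suc _ _))

nodes : List Expr → List Expr → List Expr
nodes es gs = cartesianProductWith _⊕_ es gs ++ cartesianProductWith _⊗_ es gs

∈-nodes-⊕ : ∀ {e g es gs} → e ∈ es → g ∈ gs → e ⊕ g ∈ nodes es gs
∈-nodes-⊕ e∈ g∈ = ∈-++⁺ˡ (∈-cartesianProductWith⁺ _⊕_ e∈ g∈)

∈-nodes-⊗ : ∀ {e g es gs} → e ∈ es → g ∈ gs → e ⊗ g ∈ nodes es gs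
∈-nodes-⊗ {es = es} {gs} e∈ g∈ =
  ∈-++⁺ʳ (cartesianProductWith _⊕_ es gs) (∈-cartesianProductWith⁺ _⊗_ e∈ g∈)

length-nodes : ∀ es gs → length (nodes es gs) ≡ length es * length gs + length es * length gs
length-nodes es gs = trans (length-++ (cartesianProductWith _⊕_ es gs))
  (cong₂ _+_ (length-cartesianProductWith _⊕_ es gs) (length-cartesianProductWith _⊗_ es gs))

-- enumerate h k lists the expressions with k operations and height at most h (var has height 1);
-- rootSplit h k i lists those whose left operand has i operations.
mutual
  enumerate : ℕ → ℕ → List Expr
  enumerate zero    _       = []
  enumerate (suc h) zero    = [ var ]
  enumerate (suc h) (suc k) = concatMap (rootSplit h k) (upTo (suc k))

  rootSplit : ℕ → ℕ → ℕ → List Expr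
  rootSplit h k i = nodes (enumerate h i) (enumerate h (k ∸ i))

nodes⊆enumerate : ∀ h a b → nodes (enumerate h a) (enumerate h b) ⊆ enumerate (suc h) (suc (a + b))
nodes⊆enumerate h a b x∈ =
  ∈-concatMap⁺ (rootSplit h (a + b)) (lose (∈-upTo⁺ (s≤s (m≤m+n a b))) x∈rootSplit)
  where
  x∈rootSplit : _ ∈ rootSplit h (a + b) a
  x∈rootSplit = subst (λ c → _ ∈ nodes (enumerate h a) (enumerate h c)) (sym (m+n∸m≡n a b)) x∈

∈-enumerate : ∀ e {h} → opCount e < h → e ∈ enumerate h (opCount e)
∈-enumerate var     {suc h} _        = here refl
∈-enumerate (e ⊕ g) {suc h} (s≤s lt) = nodes⊆enumerate h _ _
  (∈-nodes-⊕ (∈-enumerate e (m+n≤o⇒m≤o _ lt)) (∈-enumerate g (≤-<-trans (m≤n+m _ _) lt)))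
∈-enumerate (e ⊗ g) {suc h} (s≤s lt) = nodes⊆enumerate h _ _
  (∈-nodes-⊗ (∈-enumerate e (m+n≤o⇒m≤o _ lt)) (∈-enumerate g (≤-<-trans (m≤n+m _ _) lt)))

∈-enumerate-size : ∀ {k} e → size e ≡ suc k → e ∈ enumerate (suc k) k
∈-enumerate-size {k} e size≡ =
  subst (λ c → e ∈ enumerate (suc k) c) opCount≡ (∈-enumerate e (s≤s (≤-reflexive opCount≡)))
  where
  opCount≡ : opCount e ≡ k
  opCount≡ = suc-injective (trans (sym (size≡suc-opCount e)) size≡)

length-enumerate : ∀ h k → length (enumerate h k) ≤ suc k ^ k
length-enumerate zero    k       = z≤n
length-enumerate (suc h) zero    = ≤-refl
length-enumerate (suc h) (suc k) = begin
  length (concatMap (rootSplit h k) (upTo (suc k)))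
    ≤⟨ length-concatMap-≤ (rootSplit h k) (All.tabulate (length-rootSplit ∘ s≤s⁻¹ ∘ ∈-upTo⁻)) ⟩
  length (upTo (suc k)) * (P + P)   ≡⟨ cong (_* (P + P)) (length-upTo (suc k)) ⟩
  suc k * (P + P)                   ≡⟨ *-distribˡ-+ (suc k) P P ⟩
  suc k ^ suc k + suc k * suc k ^ k ≤⟨ bernoulli (suc k) k ⟩
  suc (suc k) ^ suc k               ∎
  where
  open ≤-Reasoning
  P = suc k ^ k
  length-enumerate-≤ : ∀ {i} → i ≤ k → length (enumerate h i) ≤ suc k ^ i
  length-enumerate-≤ {i} i≤k = ≤-trans (length-enumerate h i) (^-monoˡ-≤ i (s≤s i≤k))
  length-rootSplit : ∀ {i} → i ≤ k → length (rootSplit h k i) ≤ P + P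
  length-rootSplit {i} i≤k = begin
    length (rootSplit h k i)    ≡⟨ length-nodes (enumerate h i) (enumerate h (k ∸ i)) ⟩
    L * M + L * M               ≤⟨ +-mono-≤ L*M≤P L*M≤P ⟩
    P + P                       ∎
    where
    L = length (enumerate h i)
    M = length (enumerate h (k ∸ i))
    L*M≤P : L * M ≤ P
    L*M≤P = ≤-trans (*-mono-≤ (length-enumerate-≤ i≤k) (length-enumerate-≤ (m∸n≤m k i)))
                    (≤-reflexive (m^i*m^[n∸i]≡m^n (suc k) i≤k))

proposition3p1 : (n : ℕ) → 1 ≤ n → (fs : List Poly) → All (InK n) fs →
    AllPairs (λ f g → ¬ (f ≈ₚ g)) fs → length fs ≤ n ^ (n ∸ 1)
proposition3p1 (suc k) _ fs members distinct = ≤-trans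
  (pigeonhole (λ f e → value e ≈ₚ f) (AllPairs.map disjoint distinct) (All.map listed members))
  (length-enumerate (suc k) k)
  where
  disjoint : ∀ {f g} → ¬ f ≈ₚ g → ∀ {e} → value e ≈ₚ f → ¬ value e ≈ₚ g
  disjoint f≉g e≈f e≈g = f≉g (λ i → trans (sym (e≈f i)) (e≈g i))
  listed : ∀ {f} → InK (suc k) f → Any (λ e → value e ≈ₚ f) (enumerate (suc k) k)
  listed ((e , size≡ , e≈f) , _) = lose (∈-enumerate-size e size≡) e≈f
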